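{- Let $2\le m\le n$ and let $A$ be an $m\times n$ matrix with entries $1,\dots,mn$ (each exactly once), given as input to procedure FillColumns. Let $h\ge 0$ and suppose the configuration $A_h$ has exactly $f$ underfull columns. If $A_{h+n}$ exists, then $\Psi(A_{h+n})\le \Psi(A_h)-\frac f2$.
   Context: Rows and columns are numbered from $1$. For $x\in\{1,\dots,mn\}$ let $\mathrm{col}(x)=((x-1)\bmod n)+1$ (its target column). $R$ denotes the first row and $C_j$ the $j$-th column; $R[j]$ and $C_j[i]$ denote the element at column $j$ of $R$, respectively at row $i$ of $C_j$; so $R[j]=C_j[1]$. "Rotate $R$" means a unit rightward rotation of the first row ($R[j]\to R[j+1]$ for $j<n$, $R[n]\to R[1]$). "Rotate $C_j$" means a unit downward rotation of column $j$ ($C_j[i]\to C_j[i+1]$ for $i<m$, $C_j[m]\to C_j[1]$). The body of $C_j$ consists of positions $C_j[2],\dots,C_j[m]$. A column $C_j$ is near-full if every element $x$ in its body has $\mathrm{col}(x)=j$, and underfull otherwise. Procedure FillColumns: while there exists an underfull column, do the following (one iteration of the outer loop): for $j=1,\dots,n$ in order, while $\mathrm{col}(R[j])=j$ and $C_j$ is underfull, rotate $C_j$; after the for-loop, rotate $R$ once. Let $A_0=A$ and, for $h\ge1$, let $A_h$ be the configuration immediately after the completion of the $h$-th iteration of the outer while loop (it exists iff at least $h$ iterations are performed). For a configuration $B$, the potential $\Psi(B)$ is the number of pairs $(i,j)\in\{2,\dots,m\}\times\{1,\dots,n\}$ such that the element $x$ at row $i$, column $j$ of $B$ satisfies $\mathrm{col}(x)\ne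 j$. -}

module Defs where

open import Data.Nat using (ℕ; zero; suc; _+_; _*_; _∸_; _≤_; _<_)
open import Data.Nat.DivMod using (_%_)
open import Data.Fin using (Fin; toℕ; fromℕ; inject₁)
import Data.Fin as F
open import Data.List using (List; length; filter; map; allFin; foldl)
open import Data.Nat.ListAction using (sum)
open import Data.Product using (∃; _×_)
open import Relation.Binary.PropositionalEquality using (_≡_)
open import Relation.Nullary using (¬_; Dec; yes; no)
open import Relation.Nullary.Decidable using (_×-dec_; ¬?)
open import Data.Nat.Properties using (_≟_; _≤?_)
open import Data.Fin.Properties using (any?)

-- An m×n configuration; rows and columns are 0-based internally
-- (internal row index i corresponds to the paper's row i+1, same for columns).
Config : ℕ → ℕ → Set
Config m n = Fin m → Fin n → ℕ

-- col(x) = ((x-1) mod n) + 1  (n ≥ 1; value for n = 0 is irrelevant junk)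
col : ℕ → ℕ → ℕ
col zero    x = 0
col (suc n) x = suc ((x ∸ 1) % suc n)

predC : ∀ {k} → Fin k → Fin k
predC {suc k} F.zero    = fromℕ k
predC {suc k} (F.suc i) = inject₁ i

Misplaced : ∀ {m n} → Config m n → Fin m → Fin n → Set
Misplaced {m} {n} A i j = ¬ (col n (A i j) ≡ suc (toℕ j))

-- body position: paper row ≥ 2, i.e. internal row index ≥ 1
InBody : ∀ {m} → Fin m → Set
InBody i = 1 ≤ toℕ i

misplaced? : ∀ {m n} (A : Config m n) i j → Dec (Misplaced A i j)
misplaced? {m} {n} A i j = ¬? (col n (A i j) ≟ suc (toℕ j))

inBody? : ∀ {m} (i : Fin m) → Dec (InBody i)
inBody? i = 1 ≤? toℕ i

Underfull : ∀ {m n} → Config m n → Fin n → Set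
Underfull {m} A j = ∃ λ (i : Fin m) → InBody i × Misplaced A i j

underfull? : ∀ {m n} (A : Config m n) (j : Fin n) → Dec (Underfull A j)
underfull? A j = any? (λ i → inBody? i ×-dec misplaced? A i j)

SomeUnderfull : ∀ {m n} → Config m n → Set
SomeUnderfull {n = n} A = ∃ λ (j : Fin n) → Underfull A j

numUnderfull : ∀ {m n} → Config m n → ℕ
numUnderfull {n = n} A = length (filter (underfull? A) (allFin n))

Ψ : ∀ {m n} → Config m n → ℕ
Ψ {m} {n} A =
  sum (map (λ j → length (filter (λ i → inBody? i ×-dec misplaced? A i j) (allFin m)))
           (allFin n))

rotR : ∀ {m n} → Config m n → Config m n
rotR A i j with toℕ i ≟ 0
... | yes _ = A i (predC j)
... | no  _ = A i j

rotC : ∀ {m n} → Fin n → Config m n → Config m n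
rotC j A i j' with toℕ j' ≟ toℕ j
... | yes _ = A (predC i) j'
... | no  _ = A i j'

-- inner while loop for column j:
--   while col(R[j]) = j and C_j underfull, rotate C_j.
-- Implemented with fuel; fuel m suffices (the loop stops after at most m-1 rotations).
innerLoop : ∀ {m n} → ℕ → Fin n → Config m n → Config m n
innerLoop zero    j A = A
innerLoop {zero}  (suc k) j A = A
innerLoop {suc m} {n} (suc k) j A with col n (A F.zero j) ≟ suc (toℕ j) | underfull? A j
... | yes _ | yes _ = innerLoop k j (rotC j A)
... | _     | _     = A

outerStep : ∀ {m n} → Config m n → Config m n
outerStep {m} {n} A = rotR (foldl (λ B j → innerLoop m j B) A (allFin n))

-- A_h (as a configuration; meaningful when it exists)
iterStep : ∀ {m n} → ℕ → Config m n → Config m n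
iterStep zero    A = A
iterStep (suc h) A = outerStep (iterStep h A)

-- A_h exists iff at least h iterations are performed,
-- i.e. A_0, …, A_{h-1} each have an underfull column.
Exists : ∀ {m n} → ℕ → Config m n → Set
Exists h A = ∀ k → k < h → SomeUnderfull (iterStep k A)

IsInput : ∀ {m n} → Config m n → Set
IsInput {m} {n} A =
  (∀ i j → 1 ≤ A i j × A i j ≤ m * n) ×
  (∀ i j i' j' → A i j ≡ A i' j' → i ≡ i' × j ≡ j') ×
  (∀ x → 1 ≤ x → x ≤ m * n → ∃ λ i → ∃ λ j → A i j ≡ x)

{-# OPTIONS --safe #-}
module Submission where

-- Fix a column c, let ψ_c be the number of misplaced body entries of C_c and r the number of
-- entries x of R that belong to c (col(x) = c). Such an entry at a position p ≠ c is never touched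
-- by the for-loop, since the inner loop of column p only runs when R[p] belongs to p, and the
-- rotation of R moves it one step to the right; so within n rounds it arrives at position c.
-- On arrival either ψ_c = 0 already, or the inner loop of c rotates it into the body and ψ_c drops
-- by at least one. Hence ψ_c(A_{h+n}) ≤ ψ_c(A_h) ∸ r. Exactly m entries belong to c, and the
-- correct body entries of C_c are distinct from those in R, so r ≤ ψ_c(A_h) + 1; also the r's sum
-- to n over all columns. An elementary case analysis gives
-- 2 ψ_c(A_{h+n}) + [C_c underfull] + r ≤ 2 ψ_c(A_h) + 1, and summing over c gives the claim.

open import Defs
open import Data.Bool using (true; false; if_then_else_)
open import Data.Empty using (⊥-elim)
open import Data.Fin using (Fin; zero; suc; toℕ; fromℕ; fromℕ<; inject₁; lower₁; punchIn)
open import Data.Fin.Properties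
  using (toℕ-injective; toℕ-fromℕ; toℕ-fromℕ<; toℕ-inject₁; toℕ-lower₁; inject₁-lower₁; toℕ<n; toℕ≤pred[n];
         punchInᵢ≢i; any?)
  renaming (_≟_ to _≟ᶠ_)
open import Data.List using ([]; _∷_; length; filter; map; allFin; foldl; tabulate)
open import Data.List.Membership.Propositional using (_∈_)
open import Data.List.Membership.Propositional.Properties using (∈-allFin)
open import Data.List.Relation.Unary.Any using (here; there)
open import Data.Nat using (ℕ; zero; suc; _+_; _*_; _∸_; _≤_; _<_; z≤n; s≤s)
open import Data.Nat.DivMod using (_%_; _/_; m%n<n; m≡m%n+[m/n]*n; m<n*o⇒m/o<n)
import Data.Nat.ListAction as List
open import Data.Nat.Properties
open import Algebra.Properties.Semiring.Sum +-*-semiring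
  using (sum; sum-syntax; sum-cong-≗; sum-replicate-zero; sum-remove; sum-init-last; ∑-comm; ∑-distrib-+; *-distribˡ-sum)
open import Data.Nat.Tactic.RingSolver using (solve)
open import Data.Product using (∃; _×_; _,_; proj₁; proj₂)
open import Data.Sum using (_⊎_; inj₁; inj₂)
open import Data.Vec.Functional using (Vector)
open import Function using (_∘_)
open import Relation.Binary.PropositionalEquality
open import Relation.Nullary using (¬_; Dec; yes; no; does)
open import Relation.Nullary.Decidable using (¬?; _×-dec_)

iverson : ∀ {p} {P : Set p} → Dec P → ℕ
iverson P? = if does P? then 1 else 0

module _ {p} {P : Set p} where

  iverson-yes : P → (P? : Dec P) → iverson P? ≡ 1
  iverson-yes _ (yes _) = refl
  iverson-yes x (no ¬x) = ⊥-elim (¬x x)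

  iverson-no : ¬ P → (P? : Dec P) → iverson P? ≡ 0
  iverson-no ¬x (yes x) = ⊥-elim (¬x x)
  iverson-no _  (no _)  = refl

  iverson-≤ : ∀ {k} → (P → 1 ≤ k) → (P? : Dec P) → iverson P? ≤ k
  iverson-≤ 1≤k (yes x) = 1≤k x
  iverson-≤ 1≤k (no _)  = z≤n

  iverson+iverson-¬ : (P? : Dec P) → iverson P? + iverson (¬? P?) ≡ 1
  iverson+iverson-¬ (yes _) = refl
  iverson+iverson-¬ (no _)  = refl

iverson-mono : ∀ {p q} {P : Set p} {Q : Set q} → (P → Q) → (P? : Dec P) (Q? : Dec Q) →
  iverson P? ≤ iverson Q?
iverson-mono P→Q (yes x) Q? = ≤-reflexive (sym (iverson-yes (P→Q x) Q?))
iverson-mono P→Q (no _)  Q? = z≤n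

iverson-cong : ∀ {p q} {P : Set p} {Q : Set q} → (P → Q) → (Q → P) → (P? : Dec P) (Q? : Dec Q) →
  iverson P? ≡ iverson Q?
iverson-cong P→Q Q→P P? Q? = ≤-antisym (iverson-mono P→Q P? Q?) (iverson-mono Q→P Q? P?)

iverson-⊎ : ∀ {p q r} {P : Set p} {Q : Set q} {R : Set r} → (P → Q ⊎ R) →
  (P? : Dec P) (Q? : Dec Q) (R? : Dec R) → iverson P? ≤ iverson Q? + iverson R?
iverson-⊎ P→Q⊎R (no _)  Q? R? = z≤n
iverson-⊎ P→Q⊎R (yes x) Q? R? with P→Q⊎R x
... | inj₁ y = ≤-trans (iverson-mono (λ _ → y) (yes x) Q?) (m≤m+n _ _)
... | inj₂ z = ≤-trans (iverson-mono (λ _ → z) (yes x) R?) (m≤n+m _ _)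

sum-mono-≤ : ∀ {n} {f g : Vector ℕ n} → (∀ i → f i ≤ g i) → sum f ≤ sum g
sum-mono-≤ {zero}  f≤g = z≤n
sum-mono-≤ {suc n} f≤g = +-mono-≤ (f≤g zero) (sum-mono-≤ (f≤g ∘ suc))

term≤sum : ∀ {n} (t : Vector ℕ n) i → t i ≤ sum t
term≤sum {suc n} t i = ≤-trans (m≤m+n (t i) _) (≤-reflexive (sym (sum-remove {i = i} t)))

sum-zeros : ∀ {n} (t : Vector ℕ n) → (∀ i → t i ≡ 0) → sum t ≡ 0
sum-zeros {n} t t≡0 = trans (sum-cong-≗ t≡0) (sum-replicate-zero n)

sum-single : ∀ {n} (t : Vector ℕ n) i → (∀ j → j ≢ i → t j ≡ 0) → sum t ≡ t i
sum-single {suc n} t i t≡0 = begin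
  sum t                             ≡⟨ sum-remove {i = i} t ⟩
  t i + ∑[ j < n ] t (punchIn i j)  ≡⟨ cong (t i +_) (sum-zeros (t ∘ punchIn i) (λ j → t≡0 (punchIn i j) (punchInᵢ≢i i j))) ⟩
  t i + 0                           ≡⟨ +-identityʳ (t i) ⟩
  t i                               ∎
  where open ≡-Reasoning

∑-1 : ∀ n → ∑[ _ < n ] 1 ≡ n
∑-1 zero    = refl
∑-1 (suc n) = cong suc (∑-1 n)

∑[2f+g]≡2∑f+∑g : ∀ {n} (f g : Vector ℕ n) → ∑[ i < n ] (2 * f i + g i) ≡ 2 * sum f + sum g
∑[2f+g]≡2∑f+∑g f g = trans (∑-distrib-+ (λ i → 2 * f i) g) (cong (_+ sum g) (sym (*-distribˡ-sum 2 f)))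

∑-predC : ∀ {n} (t : Vector ℕ (suc n)) → ∑[ i < suc n ] t (predC i) ≡ sum t
∑-predC t = trans (+-comm (t (fromℕ _)) _) (sym (sum-init-last t))

∑-iverson-at : ∀ {n q} {Q : Set q} (c : Fin n) (Q? : Dec Q) → ∑[ p < n ] iverson (p ≟ᶠ c ×-dec Q?) ≡ iverson Q?
∑-iverson-at c Q? = trans
  (sum-single (λ p → iverson (p ≟ᶠ c ×-dec Q?)) c (λ p p≢c → iverson-no (p≢c ∘ proj₁) (p ≟ᶠ c ×-dec Q?)))
  (iverson-cong proj₂ (refl ,_) (c ≟ᶠ c ×-dec Q?) Q?)

length-filter-tabulate : ∀ {a p} {A : Set a} {P : A → Set p} (P? : ∀ x → Dec (P x)) {n} (f : Fin n → A) →
  length (filter P? (tabulate f)) ≡ ∑[ i < n ] iverson (P? (f i))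
length-filter-tabulate P? {zero}  f = refl
length-filter-tabulate P? {suc n} f with does (P? (f zero))
... | true  = cong suc (length-filter-tabulate P? (f ∘ suc))
... | false = length-filter-tabulate P? (f ∘ suc)

sum-map-tabulate : ∀ {a} {A : Set a} (g : A → ℕ) {n} (f : Fin n → A) →
  List.sum (map g (tabulate f)) ≡ ∑[ i < n ] g (f i)
sum-map-tabulate g {zero}  f = refl
sum-map-tabulate g {suc n} f = cong (g (f zero) +_) (sum-map-tabulate g (f ∘ suc))

BelongsTo : ∀ {n} → ℕ → Fin n → Set
BelongsTo {n} x c = col n x ≡ suc (toℕ c)

belongsTo? : ∀ {n} (x : ℕ) (c : Fin n) → Dec (BelongsTo x c)
belongsTo? {n} x c = col n x ≟ suc (toℕ c)

belongsTo-unique : ∀ {n x} {c c′ : Fin n} → BelongsTo x c → BelongsTo x c′ → c ≡ c′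
belongsTo-unique x∈c x∈c′ = toℕ-injective (suc-injective (trans (sym x∈c) x∈c′))

module _ {m n : ℕ} where

  rotC-≡ : ∀ c (B : Config m n) i → rotC c B i c ≡ B (predC i) c
  rotC-≡ c B i with toℕ c ≟ toℕ c
  ... | yes _   = refl
  ... | no  c≢c = ⊥-elim (c≢c refl)

  rotC-≢ : ∀ {c j} (B : Config m n) i → j ≢ c → rotC c B i j ≡ B i j
  rotC-≢ {c} {j} B i j≢c with toℕ j ≟ toℕ c
  ... | yes j≡c = ⊥-elim (j≢c (toℕ-injective j≡c))
  ... | no  _   = refl

module _ {m n : ℕ} where

  innerLoop-≢ : ∀ k {c j} (B : Config (suc m) n) i → j ≢ c → innerLoop k c B i j ≡ B i j
  innerLoop-≢ zero        B i j≢c = refl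
  innerLoop-≢ (suc k) {c} B i j≢c with belongsTo? (B zero c) c | underfull? B c
  ... | yes _ | yes _ = trans (innerLoop-≢ k (rotC c B) i j≢c) (rotC-≢ B i j≢c)
  ... | yes _ | no  _ = refl
  ... | no  _ | _     = refl

  innerLoop-foreignTop : ∀ k c (B : Config (suc m) n) → ¬ BelongsTo (B zero c) c → innerLoop k c B ≡ B
  innerLoop-foreignTop zero    c B _ = refl
  innerLoop-foreignTop (suc k) c B ¬top with belongsTo? (B zero c) c | underfull? B c
  ... | yes top | _ = ⊥-elim (¬top top)
  ... | no  _   | _ = refl

sweepStep : ∀ {m n} → Config (suc m) n → Fin n → Config (suc m) n
sweepStep {m} B j = innerLoop (suc m) j B

sweep-foreignTop : ∀ {m n} p l (B : Config (suc m) n) → ¬ BelongsTo (B zero p) p →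
  foldl sweepStep B l zero p ≡ B zero p
sweep-foreignTop {m} p []      B ¬top = refl
sweep-foreignTop {m} p (j ∷ l) B ¬top =
  trans (sweep-foreignTop p l (sweepStep B j) (¬top ∘ subst (λ x → BelongsTo x p) step-keeps)) step-keeps
  where
  step-keeps : sweepStep B j zero p ≡ B zero p
  step-keeps with j ≟ᶠ p
  ... | yes refl = cong (λ X → X zero p) (innerLoop-foreignTop (suc m) p B ¬top)
  ... | no  j≢p  = innerLoop-≢ (suc m) B zero (j≢p ∘ sym)

∑entries : ∀ {m n} → (ℕ → ℕ) → Config m n → ℕ
∑entries {m} {n} g B = ∑[ i < m ] ∑[ j < n ] g (B i j)

module _ {m n : ℕ} (g : ℕ → ℕ) where

  ∑entries-rotC : ∀ c (B : Config (suc m) n) → ∑entries g (rotC c B) ≡ ∑entries g B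
  ∑entries-rotC c B = begin
    ∑[ i < suc m ] ∑[ j < n ] g (rotC c B i j) ≡⟨ ∑-comm (λ i j → g (rotC c B i j)) ⟩
    ∑[ j < n ] ∑[ i < suc m ] g (rotC c B i j) ≡⟨ sum-cong-≗ column ⟩
    ∑[ j < n ] ∑[ i < suc m ] g (B i j)        ≡⟨ ∑-comm (λ i j → g (B i j)) ⟨
    ∑[ i < suc m ] ∑[ j < n ] g (B i j)        ∎
    where
    open ≡-Reasoning
    column : ∀ j → ∑[ i < suc m ] g (rotC c B i j) ≡ ∑[ i < suc m ] g (B i j)
    column j with j ≟ᶠ c
    ... | yes refl = trans (sum-cong-≗ (cong g ∘ rotC-≡ c B)) (∑-predC (λ i → g (B i c)))
    ... | no  j≢c  = sum-cong-≗ (λ i → cong g (rotC-≢ B i j≢c))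

  ∑entries-rotR : (B : Config (suc m) (suc n)) → ∑entries g (rotR B) ≡ ∑entries g B
  ∑entries-rotR B = cong (_+ ∑[ i < m ] ∑[ j < suc n ] g (B (suc i) j)) (∑-predC (λ j → g (B zero j)))

  ∑entries-innerLoop : ∀ k c (B : Config (suc m) n) → ∑entries g (innerLoop k c B) ≡ ∑entries g B
  ∑entries-innerLoop zero    c B = refl
  ∑entries-innerLoop (suc k) c B with belongsTo? (B zero c) c | underfull? B c
  ... | yes _ | yes _ = trans (∑entries-innerLoop k c (rotC c B)) (∑entries-rotC c B)
  ... | yes _ | no  _ = refl
  ... | no  _ | _     = refl

  ∑entries-sweep : ∀ l (B : Config (suc m) n) → ∑entries g (foldl sweepStep B l) ≡ ∑entries g B
  ∑entries-sweep []      B = refl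
  ∑entries-sweep (j ∷ l) B = trans (∑entries-sweep l (sweepStep B j)) (∑entries-innerLoop (suc m) j B)

∑entries-iterStep : ∀ {m n} (g : ℕ → ℕ) k (B : Config (suc m) (suc n)) → ∑entries g (iterStep k B) ≡ ∑entries g B
∑entries-iterStep {n = n} g zero    B = refl
∑entries-iterStep {n = n} g (suc k) B =
  trans (∑entries-rotR g (foldl sweepStep (iterStep k B) (allFin (suc n))))
        (trans (∑entries-sweep g (allFin (suc n)) (iterStep k B)) (∑entries-iterStep g k B))

ψ : ∀ {m n} → Fin n → Config (suc m) n → ℕ
ψ {m} c B = ∑[ i < m ] iverson (misplaced? B (suc i) c)

Ψ≡∑ψ : ∀ {m n} (B : Config (suc m) n) → Ψ B ≡ ∑[ c < n ] ψ c B
Ψ≡∑ψ {m} {n} B = trans (sum-map-tabulate misplacedIn (λ c → c))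
  (sum-cong-≗ (λ c → length-filter-tabulate (λ i → inBody? i ×-dec misplaced? B i c) suc))
  where
  misplacedIn : Fin n → ℕ
  misplacedIn c = length (filter (λ i → inBody? i ×-dec misplaced? B i c) (allFin (suc m)))

numUnderfull≡∑ : ∀ {m n} (B : Config m n) → numUnderfull B ≡ ∑[ c < n ] iverson (underfull? B c)
numUnderfull≡∑ B = length-filter-tabulate (underfull? B) (λ c → c)

module _ {m n : ℕ} where

  ψ-cong : ∀ c (B B′ : Config (suc m) n) → (∀ i → B i c ≡ B′ i c) → ψ c B ≡ ψ c B′
  ψ-cong c B B′ B≡B′ = sum-cong-≗ (λ i → cong (λ x → iverson (¬? (belongsTo? x c))) (B≡B′ (suc i)))

  underfull≤ψ : ∀ c (B : Config (suc m) n) → iverson (underfull? B c) ≤ ψ c B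
  underfull≤ψ c B = iverson-≤ misplaced⇒1≤ψ (underfull? B c)
    where
    misplaced⇒1≤ψ : Underfull B c → 1 ≤ ψ c B
    misplaced⇒1≤ψ (suc i , _ , B[i]∉c) = ≤-trans (≤-reflexive (sym (iverson-yes B[i]∉c (misplaced? B (suc i) c))))
                                                 (term≤sum (λ i → iverson (misplaced? B (suc i) c)) i)

  ψ≡0 : ∀ c (B : Config (suc m) n) → ¬ Underfull B c → ψ c B ≡ 0
  ψ≡0 c B ¬under = sum-zeros (λ i → iverson (misplaced? B (suc i) c))
    (λ i → iverson-no (λ B[i]∉c → ¬under (suc i , s≤s z≤n , B[i]∉c)) (misplaced? B (suc i) c))

  ψ-rotC : ∀ c (B : Config (suc m) n) → BelongsTo (B zero c) c →
    iverson (misplaced? B (fromℕ m) c) + ψ c (rotC c B) ≡ ψ c B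
  ψ-rotC c B top = begin
    iverson (misplaced? B (fromℕ m) c) + ψ c (rotC c B)
      ≡⟨ cong (λ x → iverson (¬? (belongsTo? x c)) + ψ c (rotC c B)) (rotC-≡ c B zero) ⟨
    ∑[ i < suc m ] iverson (misplaced? (rotC c B) i c)
      ≡⟨ sum-cong-≗ (λ i → cong (λ x → iverson (¬? (belongsTo? x c))) (rotC-≡ c B i)) ⟩
    ∑[ i < suc m ] iverson (misplaced? B (predC i) c)
      ≡⟨ ∑-predC (λ i → iverson (misplaced? B i c)) ⟩
    iverson (misplaced? B zero c) + ψ c B
      ≡⟨ cong (_+ ψ c B) (iverson-no (λ top∉c → top∉c top) (misplaced? B zero c)) ⟩
    ψ c B ∎
    where open ≡-Reasoning

  ψ-innerLoop-≤ : ∀ k c (B : Config (suc m) n) → ψ c (innerLoop k c B) ≤ ψ c B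
  ψ-innerLoop-≤ zero    c B = ≤-refl
  ψ-innerLoop-≤ (suc k) c B with belongsTo? (B zero c) c | underfull? B c
  ... | yes top | yes _ = ≤-trans (ψ-innerLoop-≤ k c (rotC c B)) (≤-trans (m≤n+m _ _) (≤-reflexive (ψ-rotC c B top)))
  ... | yes _   | no  _ = ≤-refl
  ... | no  _   | _     = ≤-refl

  -- m < k + toℕ i: enough fuel to rotate the misplaced entry at row i down past the bottom row.
  ψ-innerLoop-< : ∀ k c (B : Config (suc m) n) i → BelongsTo (B zero c) c → InBody i → Misplaced B i c →
    m < k + toℕ i → ψ c (innerLoop k c B) < ψ c B
  ψ-innerLoop-< zero    c B i _   _    _      m<i   = ⊥-elim (<⇒≱ m<i (toℕ≤pred[n] i))
  ψ-innerLoop-< (suc k) c B i top body B[i]∉c m<k+i with belongsTo? (B zero c) c | underfull? B c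
  ... | no  ¬top | _          = ⊥-elim (¬top top)
  ... | yes _    | no  ¬under = ⊥-elim (¬under (i , body , B[i]∉c))
  ... | yes _    | yes _ with belongsTo? (B (fromℕ m) c) c
  ...   | no  bottom∉c = ≤-trans (s≤s (ψ-innerLoop-≤ k c (rotC c B)))
            (≤-reflexive (trans (cong (_+ ψ c (rotC c B)) (sym (iverson-yes bottom∉c (misplaced? B (fromℕ m) c))))
                                (ψ-rotC c B top)))
  ...   | yes bottom∈c = subst (ψ c (innerLoop k c (rotC c B)) <_) ψ-unchanged
            (ψ-innerLoop-< k c (rotC c B) i′ top′ (s≤s z≤n) (B[i]∉c ∘ subst (λ x → BelongsTo x c) i′↦i) m<k+i′)
    where
    i≢bottom : m ≢ toℕ i
    i≢bottom m≡i = B[i]∉c (subst (λ r → BelongsTo (B r c) c) (toℕ-injective (trans (toℕ-fromℕ m) m≡i)) bottom∈c)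
    i′ : Fin (suc m)
    i′ = suc (lower₁ i i≢bottom)
    i′↦i : rotC c B i′ c ≡ B i c
    i′↦i = trans (rotC-≡ c B i′) (cong (λ r → B r c) (inject₁-lower₁ i i≢bottom))
    top′ : BelongsTo (rotC c B zero c) c
    top′ = subst (λ x → BelongsTo x c) (sym (rotC-≡ c B zero)) bottom∈c
    m<k+i′ : m < k + toℕ i′
    m<k+i′ = subst (m <_) (trans (sym (+-suc k (toℕ i))) (cong (λ r → k + suc r) (sym (toℕ-lower₁ i i≢bottom)))) m<k+i
    ψ-unchanged : ψ c (rotC c B) ≡ ψ c B
    ψ-unchanged = trans (cong (_+ ψ c (rotC c B)) (sym (iverson-no (λ bottom∉c → bottom∉c bottom∈c) (misplaced? B (fromℕ m) c))))
                        (ψ-rotC c B top)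

  ψ-sweepStep-≤ : ∀ c (B : Config (suc m) n) j → ψ c (sweepStep B j) ≤ ψ c B
  ψ-sweepStep-≤ c B j with j ≟ᶠ c
  ... | yes refl = ψ-innerLoop-≤ (suc m) c B
  ... | no  j≢c  = ≤-reflexive (ψ-cong c (sweepStep B j) B (λ i → innerLoop-≢ (suc m) B i (j≢c ∘ sym)))

  ψ-sweep-≤ : ∀ c l (B : Config (suc m) n) → ψ c (foldl sweepStep B l) ≤ ψ c B
  ψ-sweep-≤ c []      B = ≤-refl
  ψ-sweep-≤ c (j ∷ l) B = ≤-trans (ψ-sweep-≤ c l (sweepStep B j)) (ψ-sweepStep-≤ c B j)

  ψ-sweep-< : ∀ {c} (B : Config (suc m) n) → BelongsTo (B zero c) c → Underfull B c →
    ∀ {l} → c ∈ l → ψ c (foldl sweepStep B l) < ψ c B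
  ψ-sweep-< {c} B top (i , body , B[i]∉c) = go B (λ _ → refl)
    where
    go : ∀ S → (∀ r → S r c ≡ B r c) → ∀ {l} → c ∈ l → ψ c (foldl sweepStep S l) < ψ c B
    go S S≡B {j ∷ l} c∈j∷l with j ≟ᶠ c | c∈j∷l
    ... | yes refl | _ = begin-strict
      ψ c (foldl sweepStep (sweepStep S c) l) ≤⟨ ψ-sweep-≤ c l (sweepStep S c) ⟩
      ψ c (sweepStep S c)                     <⟨ ψ-innerLoop-< (suc m) c S i
                                                   (subst (λ x → BelongsTo x c) (sym (S≡B zero)) top) body
                                                   (B[i]∉c ∘ subst (λ x → BelongsTo x c) (S≡B i)) (m≤m+n (suc m) (toℕ i)) ⟩
      ψ c S                                   ≡⟨ ψ-cong c S B S≡B ⟩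
      ψ c B                                   ∎
      where open ≤-Reasoning
    ... | no  j≢c  | here c≡j  = ⊥-elim (j≢c (sym c≡j))
    ... | no  j≢c  | there c∈l = go (sweepStep S j) (λ r → trans (innerLoop-≢ (suc m) S r (j≢c ∘ sym)) (S≡B r)) c∈l

stepsTo : ∀ {n} → Fin n → Fin n → ℕ
stepsTo {n} c p with toℕ p ≤? toℕ c
... | yes _ = toℕ c ∸ toℕ p
... | no  _ = n + toℕ c ∸ toℕ p

module _ {n : ℕ} where

  stepsTo-≤ : ∀ {c p : Fin n} → toℕ p ≤ toℕ c → stepsTo c p ≡ toℕ c ∸ toℕ p
  stepsTo-≤ {c} {p} p≤c with toℕ p ≤? toℕ c
  ... | yes _   = refl
  ... | no  p≰c = ⊥-elim (p≰c p≤c)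

  stepsTo-> : ∀ {c p : Fin n} → toℕ c < toℕ p → stepsTo c p ≡ n + toℕ c ∸ toℕ p
  stepsTo-> {c} {p} c<p with toℕ p ≤? toℕ c
  ... | yes p≤c = ⊥-elim (<⇒≱ c<p p≤c)
  ... | no  _   = refl

  stepsTo<n : ∀ (c p : Fin n) → stepsTo c p < n
  stepsTo<n c p with toℕ p ≤? toℕ c
  ... | yes _   = ≤-<-trans (m∸n≤m (toℕ c) (toℕ p)) (toℕ<n c)
  ... | no  p≰c = ≤-trans (∸-monoʳ-< (≰⇒> p≰c) (≤-trans (<⇒≤ (toℕ<n p)) (m≤m+n n (toℕ c))))
                          (≤-reflexive (m+n∸n≡m n (toℕ c)))

stepsTo-predC : ∀ {n} {c : Fin (suc n)} j → predC j ≢ c → stepsTo c (predC j) ≡ suc (stepsTo c j)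
stepsTo-predC {n} {c} zero last≢c = begin
  stepsTo c (fromℕ n)            ≡⟨ stepsTo-> (subst (toℕ c <_) (sym (toℕ-fromℕ n)) c<n) ⟩
  suc n + toℕ c ∸ toℕ (fromℕ n)  ≡⟨ cong (suc n + toℕ c ∸_) (toℕ-fromℕ n) ⟩
  suc n + toℕ c ∸ n              ≡⟨ cong (_∸ n) (trans (+-comm (suc n) (toℕ c)) (+-suc (toℕ c) n)) ⟩
  suc (toℕ c) + n ∸ n            ≡⟨ m+n∸n≡m (suc (toℕ c)) n ⟩
  suc (toℕ c)                    ≡⟨ cong suc (stepsTo-≤ {p = zero} z≤n) ⟨
  suc (stepsTo c zero)           ∎
  where
  open ≡-Reasoning
  c<n : toℕ c < n
  c<n = ≤∧≢⇒< (toℕ≤pred[n] c) (λ c≡n → last≢c (toℕ-injective (trans (toℕ-fromℕ n) (sym c≡n))))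
stepsTo-predC {n} {c} (suc i) i≢c with toℕ (suc i) ≤? toℕ c
... | yes i<c = begin
  stepsTo c (inject₁ i)              ≡⟨ stepsTo-≤ (≤-trans (≤-reflexive (toℕ-inject₁ i)) (<⇒≤ i<c)) ⟩
  toℕ c ∸ toℕ (inject₁ i)            ≡⟨ cong (toℕ c ∸_) (toℕ-inject₁ i) ⟩
  toℕ c ∸ toℕ i                      ≡⟨ +-∸-assoc 1 i<c ⟩
  suc (toℕ c ∸ suc (toℕ i))          ∎
  where open ≡-Reasoning
... | no  i≮c = begin
  stepsTo c (inject₁ i)              ≡⟨ stepsTo-> c<i ⟩
  suc n + toℕ c ∸ toℕ (inject₁ i)    ≡⟨ cong (suc n + toℕ c ∸_) (toℕ-inject₁ i) ⟩
  suc n + toℕ c ∸ toℕ i              ≡⟨ +-∸-assoc 1 (≤-trans (<⇒≤ (toℕ<n (suc i))) (m≤m+n (suc n) (toℕ c))) ⟩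
  suc (suc n + toℕ c ∸ suc (toℕ i))  ∎
  where
  open ≡-Reasoning
  c<i : toℕ c < toℕ (inject₁ i)
  c<i = ≤∧≢⇒< (≤-trans (≮⇒≥ i≮c) (≤-reflexive (sym (toℕ-inject₁ i)))) (λ c≡i → i≢c (toℕ-injective (sym c≡i)))

rowMembers : ∀ {m n} → Fin n → Config (suc m) n → ℕ
rowMembers {n = n} c B = ∑[ p < n ] iverson (belongsTo? (B zero p) c)

-- The members of c in R that reach position c within the n ∸ k rounds left of a block of n rounds.
incoming : ∀ {m n} → Fin n → ℕ → Config (suc m) n → ℕ
incoming {n = n} c k B = ∑[ p < n ] iverson (belongsTo? (B zero p) c ×-dec stepsTo c p + k <? n)

module _ {m n : ℕ} (c : Fin n) where

  incoming-0 : (B : Config (suc m) n) → incoming c 0 B ≡ rowMembers c B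
  incoming-0 B = sum-cong-≗ (λ p → iverson-cong proj₁
    (λ B[p]∈c → B[p]∈c , subst (_< n) (sym (+-identityʳ (stepsTo c p))) (stepsTo<n c p))
    (belongsTo? (B zero p) c ×-dec stepsTo c p + 0 <? n) (belongsTo? (B zero p) c))

  incoming-n : (B : Config (suc m) n) → incoming c n B ≡ 0
  incoming-n B = sum-zeros (λ p → iverson (belongsTo? (B zero p) c ×-dec stepsTo c p + n <? n))
    (λ p → iverson-no (λ (_ , late) → m+n≮n (stepsTo c p) n late) (belongsTo? (B zero p) c ×-dec stepsTo c p + n <? n))

incoming-outerStep : ∀ {m n} (c : Fin (suc n)) k (B : Config (suc m) (suc n)) →
  incoming c k B ≤ iverson (belongsTo? (B zero c) c) + incoming c (suc k) (outerStep B)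
incoming-outerStep {m} {n} c k B = begin
  incoming c k B
    ≤⟨ sum-mono-≤ (λ p → iverson-⊎ (at-c-or-later p) (belongsTo? (B zero p) c ×-dec stepsTo c p + k <? suc n)
                                    (p ≟ᶠ c ×-dec top?) (later? p)) ⟩
  ∑[ p < suc n ] (iverson (p ≟ᶠ c ×-dec top?) + iverson (later? p))
    ≡⟨ ∑-distrib-+ (λ p → iverson (p ≟ᶠ c ×-dec top?)) (iverson ∘ later?) ⟩
  ∑[ p < suc n ] iverson (p ≟ᶠ c ×-dec top?) + ∑[ p < suc n ] iverson (later? p)
    ≡⟨ cong₂ _+_ (∑-iverson-at c top?) (sym (∑-predC (iverson ∘ later?))) ⟩
  iverson top? + ∑[ j < suc n ] iverson (later? (predC j))
    ≤⟨ +-monoʳ-≤ (iverson top?) (sum-mono-≤ (λ j → iverson-mono (one-step-closer j) (later? (predC j))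
                   (belongsTo? (outerStep B zero j) c ×-dec stepsTo c j + suc k <? suc n))) ⟩
  iverson top? + incoming c (suc k) (outerStep B) ∎
  where
  open ≤-Reasoning
  top? = belongsTo? (B zero c) c
  G : Config (suc m) (suc n)
  G = foldl sweepStep B (allFin (suc n))
  Later : Fin (suc n) → Set
  Later p = p ≢ c × BelongsTo (G zero p) c × stepsTo c p + k < suc n
  later? : ∀ p → Dec (Later p)
  later? p = ¬? (p ≟ᶠ c) ×-dec belongsTo? (G zero p) c ×-dec stepsTo c p + k <? suc n
  at-c-or-later : ∀ p → BelongsTo (B zero p) c × stepsTo c p + k < suc n → (p ≡ c × BelongsTo (B zero c) c) ⊎ Later p
  at-c-or-later p (B[p]∈c , soon) with p ≟ᶠ c
  ... | yes refl = inj₁ (refl , B[p]∈c)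
  ... | no  p≢c  = inj₂ (p≢c , subst (λ x → BelongsTo x c) (sym G[p]≡B[p]) B[p]∈c , soon)
    where
    G[p]≡B[p] : G zero p ≡ B zero p
    G[p]≡B[p] = sweep-foreignTop p (allFin (suc n)) B (λ B[p]∈p → p≢c (belongsTo-unique {x = B zero p} B[p]∈p B[p]∈c))
  one-step-closer : ∀ j → Later (predC j) → BelongsTo (outerStep B zero j) c × stepsTo c j + suc k < suc n
  one-step-closer j (pj≢c , G∈c , soon) =
    G∈c , subst (_< suc n) (trans (cong (_+ k) (stepsTo-predC j pj≢c)) (sym (+-suc (stepsTo c j) k))) soon

module _ {m n : ℕ} (c : Fin (suc n)) where

  ψ∸incoming-outerStep : ∀ k (B : Config (suc m) (suc n)) →
    ψ c (outerStep B) ∸ incoming c (suc k) (outerStep B) ≤ ψ c B ∸ incoming c k B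
  ψ∸incoming-outerStep k B = by-top (belongsTo? (B zero c) c) (incoming-outerStep c k B)
    where
    G = foldl sweepStep B (allFin (suc n))
    q′ = incoming c (suc k) (outerStep B)
    by-top : (top? : Dec (BelongsTo (B zero c) c)) → incoming c k B ≤ iverson top? + q′ →
      ψ c G ∸ q′ ≤ ψ c B ∸ incoming c k B
    by-top (no _)    q≤q′   = ∸-mono (ψ-sweep-≤ c (allFin (suc n)) B) q≤q′
    by-top (yes top) q≤1+q′ with underfull? B c
    ... | yes under  = ∸-mono (ψ-sweep-< B top under (∈-allFin c)) q≤1+q′
    ... | no  ¬under = ≤-trans (m∸n≤m (ψ c G) q′)
                         (≤-trans (ψ-sweep-≤ c (allFin (suc n)) B) (≤-trans (≤-reflexive (ψ≡0 c B ¬under)) z≤n))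

  ψ∸incoming-iterStep : ∀ k (B : Config (suc m) (suc n)) →
    ψ c (iterStep k B) ∸ incoming c k (iterStep k B) ≤ ψ c B ∸ incoming c 0 B
  ψ∸incoming-iterStep zero    B = ≤-refl
  ψ∸incoming-iterStep (suc k) B = ≤-trans (ψ∸incoming-outerStep k (iterStep k B)) (ψ∸incoming-iterStep k B)

  ψ-iterStep : (B : Config (suc m) (suc n)) → ψ c (iterStep (suc n) B) ≤ ψ c B ∸ rowMembers c B
  ψ-iterStep B = begin
    ψ c B′                        ≡⟨ cong (ψ c B′ ∸_) (incoming-n c B′) ⟨
    ψ c B′ ∸ incoming c (suc n) B′ ≤⟨ ψ∸incoming-iterStep (suc n) B ⟩
    ψ c B ∸ incoming c 0 B        ≡⟨ cong (ψ c B ∸_) (incoming-0 c B) ⟩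
    ψ c B ∸ rowMembers c B        ∎
    where
    open ≤-Reasoning
    B′ = iterStep (suc n) B

members : ∀ {m n} → Fin n → Config m n → ℕ
members c = ∑entries (λ x → iverson (belongsTo? x c))

rowMembers≤1+ψ : ∀ {m n} c (B : Config (suc m) n) → members c B ≤ suc m → rowMembers c B ≤ suc (ψ c B)
rowMembers≤1+ψ {m} {n} c B members≤1+m = +-cancelʳ-≤ correct (rowMembers c B) (suc (ψ c B)) (begin
  rowMembers c B + correct
    ≤⟨ +-monoʳ-≤ (rowMembers c B) (sum-mono-≤ (λ i → term≤sum (λ j → iverson (belongsTo? (B (suc i) j) c)) c)) ⟩
  members c B            ≤⟨ members≤1+m ⟩
  suc m                  ≡⟨ cong suc correct+ψ ⟨
  suc (correct + ψ c B)  ≡⟨ cong suc (+-comm correct (ψ c B)) ⟩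
  suc (ψ c B) + correct  ∎)
  where
  open ≤-Reasoning
  correct = ∑[ i < m ] iverson (belongsTo? (B (suc i) c) c)
  correct+ψ : correct + ψ c B ≡ m
  correct+ψ = begin-equality
    correct + ψ c B
      ≡⟨ ∑-distrib-+ (λ i → iverson (belongsTo? (B (suc i) c) c)) (λ i → iverson (misplaced? B (suc i) c)) ⟨
    ∑[ i < m ] (iverson (belongsTo? (B (suc i) c) c) + iverson (misplaced? B (suc i) c))
      ≡⟨ sum-cong-≗ (λ i → iverson+iverson-¬ (belongsTo? (B (suc i) c) c)) ⟩
    ∑[ i < m ] 1
      ≡⟨ ∑-1 m ⟩
    m ∎

module _ {n : ℕ} where

  belongsTo-colIndex : ∀ x → BelongsTo {suc n} x (fromℕ< (m%n<n (x ∸ 1) (suc n)))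
  belongsTo-colIndex x = cong suc (sym (toℕ-fromℕ< (m%n<n (x ∸ 1) (suc n))))

  ∑-belongsTo : ∀ x → ∑[ c < suc n ] iverson (belongsTo? x c) ≡ 1
  ∑-belongsTo x = trans
    (sum-single (λ c → iverson (belongsTo? x c)) c₀
      (λ c c≢c₀ → iverson-no (λ x∈c → c≢c₀ (belongsTo-unique {x = x} x∈c (belongsTo-colIndex x))) (belongsTo? x c)))
    (iverson-yes (belongsTo-colIndex x) (belongsTo? x c₀))
    where c₀ = fromℕ< (m%n<n (x ∸ 1) (suc n))

  belongsTo⇒≡1+c+t*n : ∀ {m x} {c : Fin (suc n)} → 1 ≤ x → x ≤ m * suc n → BelongsTo x c →
    ∃ λ (t : Fin m) → x ≡ suc (toℕ c + toℕ t * suc n)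
  belongsTo⇒≡1+c+t*n {m} {suc x} {c} _ x<mn x∈c = fromℕ< x/n<m , cong suc (begin
    x                                   ≡⟨ m≡m%n+[m/n]*n x (suc n) ⟩
    x % suc n + x / suc n * suc n       ≡⟨ cong₂ (λ a b → a + b * suc n) (suc-injective x∈c) (sym (toℕ-fromℕ< x/n<m)) ⟩
    toℕ c + toℕ (fromℕ< x/n<m) * suc n  ∎)
    where
    open ≡-Reasoning
    x/n<m : x / suc n < m
    x/n<m = m<n*o⇒m/o<n x<mn

∑-rowMembers : ∀ {m n} (B : Config (suc m) (suc n)) → ∑[ c < suc n ] rowMembers c B ≡ suc n
∑-rowMembers {n = n} B = begin
  ∑[ c < suc n ] ∑[ p < suc n ] iverson (belongsTo? (B zero p) c) ≡⟨ ∑-comm (λ c p → iverson (belongsTo? (B zero p) c)) ⟩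
  ∑[ p < suc n ] ∑[ c < suc n ] iverson (belongsTo? (B zero p) c) ≡⟨ sum-cong-≗ (λ p → ∑-belongsTo {n} (B zero p)) ⟩
  ∑[ p < suc n ] 1                                                ≡⟨ ∑-1 (suc n) ⟩
  suc n                                                           ∎
  where open ≡-Reasoning

occurrences≤1 : ∀ {m n} (A : Config m n) → (∀ i j i′ j′ → A i j ≡ A i′ j′ → i ≡ i′ × j ≡ j′) →
  ∀ w → ∑[ i < m ] ∑[ j < n ] iverson (A i j ≟ w) ≤ 1
occurrences≤1 {m} {n} A injective w with any? (λ i → any? (λ j → A i j ≟ w))
... | no  w∉A = ≤-trans (≤-reflexive (sum-zeros (λ i → ∑[ j < n ] iverson (A i j ≟ w)) (λ i →
    sum-zeros (λ j → iverson (A i j ≟ w)) (λ j → iverson-no (λ A[i,j]≡w → w∉A (i , j , A[i,j]≡w)) (A i j ≟ w))))) z≤n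
... | yes (i₀ , j₀ , A[i₀,j₀]≡w) = begin
  ∑[ i < m ] ∑[ j < n ] iverson (A i j ≟ w) ≡⟨ sum-single (λ i → ∑[ j < n ] iverson (A i j ≟ w)) i₀ other-row ⟩
  ∑[ j < n ] iverson (A i₀ j ≟ w)           ≡⟨ sum-single (λ j → iverson (A i₀ j ≟ w)) j₀ other-column ⟩
  iverson (A i₀ j₀ ≟ w)                     ≤⟨ iverson-≤ (λ _ → ≤-refl) (A i₀ j₀ ≟ w) ⟩
  1                                         ∎
  where
  open ≤-Reasoning
  other-row : ∀ i → i ≢ i₀ → ∑[ j < n ] iverson (A i j ≟ w) ≡ 0
  other-row i i≢i₀ = sum-zeros (λ j → iverson (A i j ≟ w))
    (λ j → iverson-no (λ A[i,j]≡w → i≢i₀ (proj₁ (injective i j i₀ j₀ (trans A[i,j]≡w (sym A[i₀,j₀]≡w))))) (A i j ≟ w))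
  other-column : ∀ j → j ≢ j₀ → iverson (A i₀ j ≟ w) ≡ 0
  other-column j j≢j₀ =
    iverson-no (λ A[i₀,j]≡w → j≢j₀ (proj₂ (injective i₀ j i₀ j₀ (trans A[i₀,j]≡w (sym A[i₀,j₀]≡w))))) (A i₀ j ≟ w)

members≤m : ∀ {m n} (A : Config m (suc n)) → (∀ i j → 1 ≤ A i j × A i j ≤ m * suc n) →
  (∀ i j i′ j′ → A i j ≡ A i′ j′ → i ≡ i′ × j ≡ j′) → ∀ c → members c A ≤ m
members≤m {m} {n} A inRange injective c = begin
  ∑[ i < m ] ∑[ j < suc n ] iverson (belongsTo? (A i j) c)
    ≤⟨ sum-mono-≤ (λ i → sum-mono-≤ (λ j → belongsTo≤occurrences (A i j) (inRange i j))) ⟩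
  ∑[ i < m ] ∑[ j < suc n ] ∑[ t < m ] iverson (A i j ≟ value t)
    ≡⟨ sum-cong-≗ (λ i → ∑-comm (λ j t → iverson (A i j ≟ value t))) ⟩
  ∑[ i < m ] ∑[ t < m ] ∑[ j < suc n ] iverson (A i j ≟ value t)
    ≡⟨ ∑-comm (λ i t → ∑[ j < suc n ] iverson (A i j ≟ value t)) ⟩
  ∑[ t < m ] ∑[ i < m ] ∑[ j < suc n ] iverson (A i j ≟ value t)
    ≤⟨ sum-mono-≤ (λ t → occurrences≤1 A injective (value t)) ⟩
  ∑[ t < m ] 1
    ≡⟨ ∑-1 m ⟩
  m ∎
  where
  open ≤-Reasoning
  value : Fin m → ℕ
  value t = suc (toℕ c + toℕ t * suc n)
  belongsTo≤occurrences : ∀ x → 1 ≤ x × x ≤ m * suc n → iverson (belongsTo? x c) ≤ ∑[ t < m ] iverson (x ≟ value t)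
  belongsTo≤occurrences x (1≤x , x≤mn) = iverson-≤ occurs (belongsTo? x c)
    where
    occurs : BelongsTo x c → 1 ≤ ∑[ t < m ] iverson (x ≟ value t)
    occurs x∈c with belongsTo⇒≡1+c+t*n 1≤x x≤mn x∈c
    ... | t , x≡value = ≤-trans (≤-reflexive (sym (iverson-yes x≡value (x ≟ value t))))
                                (term≤sum (λ t → iverson (x ≟ value t)) t)

2a′+u+r≤2a+1 : ∀ {a a′ u r} → a′ ≤ a ∸ r → u ≤ a → u ≤ 1 → r ≤ suc a → 2 * a′ + u + r ≤ 2 * a + 1
2a′+u+r≤2a+1 {a} {a′} {u} {r} a′≤a∸r u≤a u≤1 r≤1+a with r ≤? a
... | yes r≤a = begin
  2 * a′ + u + r     ≡⟨ solve (a′ ∷ u ∷ r ∷ []) ⟩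
  a′ + (a′ + r) + u  ≤⟨ +-mono-≤ (+-mono-≤ (≤-trans (m≤m+n a′ r) a′+r≤a) a′+r≤a) u≤1 ⟩
  a + a + 1          ≡⟨ solve (a ∷ []) ⟩
  2 * a + 1          ∎
  where
  open ≤-Reasoning
  a′+r≤a : a′ + r ≤ a
  a′+r≤a = ≤-trans (+-monoˡ-≤ r a′≤a∸r) (≤-reflexive (m∸n+n≡m r≤a))
... | no  r≰a = begin
  2 * a′ + u + r     ≡⟨ cong (λ x → 2 * x + u + r) a′≡0 ⟩
  u + r              ≤⟨ +-mono-≤ u≤a r≤1+a ⟩
  a + suc a          ≡⟨ solve (a ∷ []) ⟩
  2 * a + 1          ∎
  where
  open ≤-Reasoning
  a′≡0 : a′ ≡ 0
  a′≡0 = n≤0⇒n≡0 (≤-trans a′≤a∸r (≤-reflexive (m≤n⇒m∸n≡0 (≤-trans (n≤1+n a) (≰⇒> r≰a)))))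

module _ {m n : ℕ} (B : Config (suc m) (suc n)) (members≤1+m : ∀ c → members c B ≤ suc m) where

  column-progress : ∀ c →
    2 * ψ c (iterStep (suc n) B) + iverson (underfull? B c) + rowMembers c B ≤ 2 * ψ c B + 1
  column-progress c = 2a′+u+r≤2a+1 (ψ-iterStep c B) (underfull≤ψ c B) (iverson-≤ (λ _ → ≤-refl) (underfull? B c))
                                   (rowMembers≤1+ψ c B (members≤1+m c))

  Ψ-iterStep : 2 * Ψ (iterStep (suc n) B) + numUnderfull B ≤ 2 * Ψ B
  Ψ-iterStep = +-cancelʳ-≤ (suc n) _ _ (begin
    2 * Ψ B′ + numUnderfull B + suc n
      ≡⟨ cong₂ (λ x y → 2 * x + y + suc n) (Ψ≡∑ψ B′) (numUnderfull≡∑ B) ⟩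
    2 * sum ψ′ + sum u + suc n
      ≡⟨ cong (2 * sum ψ′ + sum u +_) (∑-rowMembers B) ⟨
    2 * sum ψ′ + sum u + sum r
      ≡⟨ cong (_+ sum r) (∑[2f+g]≡2∑f+∑g ψ′ u) ⟨
    ∑[ c < suc n ] (2 * ψ′ c + u c) + sum r
      ≡⟨ ∑-distrib-+ (λ c → 2 * ψ′ c + u c) r ⟨
    ∑[ c < suc n ] (2 * ψ′ c + u c + r c)
      ≤⟨ sum-mono-≤ column-progress ⟩
    ∑[ c < suc n ] (2 * ψ c B + 1)
      ≡⟨ ∑[2f+g]≡2∑f+∑g (λ c → ψ c B) (λ _ → 1) ⟩
    2 * ∑[ c < suc n ] ψ c B + ∑[ _ < suc n ] 1
      ≡⟨ cong₂ (λ x y → 2 * x + y) (sym (Ψ≡∑ψ B)) (∑-1 (suc n)) ⟩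
    2 * Ψ B + suc n ∎)
    where
    open ≤-Reasoning
    B′ = iterStep (suc n) B
    ψ′ u r : Fin (suc n) → ℕ
    ψ′ c = ψ c B′
    u c = iverson (underfull? B c)
    r c = rowMembers c B

iterStep-+ : ∀ {m n} h k (A : Config m n) → iterStep (h + k) A ≡ iterStep k (iterStep h A)
iterStep-+ h zero    A = cong (λ t → iterStep t A) (+-identityʳ h)
iterStep-+ h (suc k) A = trans (cong (λ t → iterStep t A) (+-suc h k)) (cong outerStep (iterStep-+ h k A))

lemma3 : (m n : ℕ) → 2 ≤ m → m ≤ n → (A : Config m n) → IsInput A →
    (h f : ℕ) → numUnderfull (iterStep h A) ≡ f → Exists (h + n) A →
    2 * Ψ (iterStep (h + n) A) + f ≤ 2 * Ψ (iterStep h A)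
lemma3 zero    n       ()  _  A _ h f _ _
lemma3 (suc m) zero    _   () A _ h f _ _
lemma3 (suc m) (suc n) _   _  A (inRange , injective , _) h f refl _ =
  subst (λ X → 2 * Ψ X + numUnderfull Aₕ ≤ 2 * Ψ Aₕ) (sym (iterStep-+ h (suc n) A))
    (Ψ-iterStep Aₕ (λ c → subst (_≤ suc m) (sym (∑entries-iterStep (λ x → iverson (belongsTo? x c)) h A))
                                         (members≤m A inRange injective c)))
  where
  Aₕ = iterStep h A
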